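{- Let $\mathbf{s}=(s_1,\ldots,s_k)$ be a composition. For every prime $p$ there is a convergent $p$-adic series equality \[ H_{p-1}(s_1,\ldots,s_k)=(-1)^{s_1+\cdots+s_k}\sum_{r_1,\ldots,r_k\geq0}\left[\prod_{j=1}^k\binom{s_j+r_j-1}{r_j}\right]p^{r_1+\cdots+r_k}H_{p-1}(s_k+r_k,\ldots,s_1+r_1). \]
   Context: A composition is a finite ordered tuple of positive integers. For a positive integer $n$ and composition $(s_1,\ldots,s_k)$, $H_n(s_1,\ldots,s_k)=\sum_{n\geq n_1>\cdots>n_k\geq1}n_1^{ -s_1}\cdots n_k^{ -s_k}\in\mathbb{Q}$. -}

module Defs where

open import Data.Nat as ℕ using (ℕ; zero; suc; _∸_)
open import Data.Nat.Combinatorics using (_C_)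
open import Data.Nat.Divisibility using (_∣_)
open import Data.Integer as ℤ using (ℤ; +_; ∣_∣)
open import Data.Rational using (ℚ; _/_; _+_; _*_; _-_; -_; 0ℚ; 1ℚ; ↥_)
open import Data.List using (List; []; _∷_; reverse; zipWith; map; concatMap; upTo; foldr)

powℚ : ℚ → ℕ → ℚ
powℚ x zero = 1ℚ
powℚ x (suc n) = x * powℚ x n

invPow : (j : ℕ) → ℕ → ℚ
invPow j s = powℚ (+ 1 / suc j) s

-- Multiple harmonic sum:
-- H n (s₁ ∷ … ∷ sₖ) = Σ_{n ≥ n₁ > … > nₖ ≥ 1} n₁^{-s₁} ⋯ nₖ^{-sₖ},
-- computed by H n (s ∷ ss) = Σ_{m=1}^{n} m^{-s} H (m-1) ss, and H n [] = 1.
H : ℕ → List ℕ → ℚ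
H n [] = 1ℚ
H zero (s ∷ ss) = 0ℚ
H (suc n) (s ∷ ss) = invPow n s * H n ss + H n (s ∷ ss)

sumℕ : List ℕ → ℕ
sumℕ = foldr ℕ._+_ 0

sumℚ : List ℚ → ℚ
sumℚ = foldr _+_ 0ℚ

prodℚ : List ℚ → ℚ
prodℚ = foldr _*_ 1ℚ

-- all lists r of naturals of length k with r₁ + ⋯ + rₖ ≤ M
tuples : ℕ → ℕ → List (List ℕ)
tuples zero M = [] ∷ []
tuples (suc k) M = concatMap (λ r → map (r ∷_) (tuples k (M ∸ r))) (upTo (suc M))

length' : List ℕ → ℕ
length' [] = 0
length' (_ ∷ xs) = suc (length' xs)

ℕtoℚ : ℕ → ℚ
ℕtoℚ n = + n / 1

term : (p : ℕ) → List ℕ → List ℕ → ℚ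
term p s r =
  prodℚ (zipWith (λ sj rj → ℕtoℚ ((sj ℕ.+ rj ∸ 1) C rj)) s r)
  * ℕtoℚ (p ℕ.^ sumℕ r)
  * H (p ∸ 1) (reverse (zipWith ℕ._+_ s r))

partialSum : (p : ℕ) → List ℕ → ℕ → ℚ
partialSum p s M = sumℚ (map (term p s) (tuples (length' s) M))

signℚ : ℕ → ℚ
signℚ n = powℚ (- 1ℚ) n

-- p-adic closeness: v_p(x - y) ≥ N  (x - y written in lowest terms, so
-- this is p^N dividing its numerator; true when x = y)
padicClose : (p N : ℕ) → ℚ → ℚ → Set
padicClose p N x y = (p ℕ.^ N) ∣ ∣ ↥ (x - y) ∣

{-# OPTIONS --safe #-}

-- For 1 ≤ m ≤ p − 1 put m′ = p − m. Then 1/m = −(1/m′)(1 − p/m′)⁻¹, so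
-- 1/m^s = (−1)^s Σ_r C(s+r−1, r) p^r / m′^(s+r), and since m′ is prime to p the tail after r = M
-- lies in p^(M+1) ℤ₍ₚ₎. Multiplying these expansions over the indices n₁ > ⋯ > n_k of a term of
-- H_{p−1}(s) is a Cauchy product whose truncation at total degree M obeys the same bound, and the
-- substitution n_j ↦ p − n_j reverses the order of the indices, so summing over all index tuples
-- produces exactly the values H_{p−1}(s_k + r_k, …, s_1 + r_1).

module Submission where

open import Defs
open import Data.Nat using (ℕ; _≤_; _∸_)
open import Data.Nat.Primality using (Prime)
open import Data.List using (List)
open import Data.List.Relation.Unary.All using (All)
open import Data.Product using (∃-syntax)
open import Data.Rational using (_*_)

open import Data.Empty using (⊥-elim)
open import Data.Integer as ℤ using (ℤ; +_; -[1+_])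
import Data.Integer.GCD as ℤ
import Data.Integer.Properties as ℤ
open import Data.List using ([]; _∷_; _++_; _∷ʳ_; length; map; reverse; zipWith; upTo; concatMap)
import Data.List.Properties as List
import Data.List.Relation.Unary.All as All
import Data.List.Relation.Unary.All.Properties as AllP
open import Data.Nat as ℕ using (zero; suc; _<_; _^_; s≤s; z≤n)
import Data.Nat.Coprimality as Coprime
open import Data.Nat.Combinatorics using (_C_; nCk+nC[k+1]≡[n+1]C[k+1]; k>n⇒nCk≡0)
open import Data.Nat.Divisibility as ℕ using (_∣_; divides)
open import Data.Nat.Primality using (¬prime[1]; prime⇒nonZero; euclidsLemma)
import Data.Nat.Properties as ℕ
open import Data.Product using (_,_)
open import Data.Rational as ℚ using (ℚ; mkℚ; _+_; _-_; -_; 0ℚ; 1ℚ; ↥_; ↧_)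
import Data.Rational.Properties as ℚ
open import Data.Sum using (inj₁; inj₂)
open import Relation.Binary.PropositionalEquality
open import Relation.Nullary using (¬_; dec⇒maybe)
open import Tactic.RingSolver using (solve-∀)
import Tactic.RingSolver.Core.AlmostCommutativeRing as ACR

-- Without the zero test the solver cannot discard vanishing coefficients and its normal forms fail to match.
ℚ-ring : ACR.AlmostCommutativeRing _ _
ℚ-ring = ACR.fromCommutativeRing ℚ.+-*-commutativeRing (λ x → dec⇒maybe (0ℚ ℚ.≟ x))

ι : ℤ → ℚ
ι i = i ℚ./ 1

-- Normalising i / 1 gets stuck on a gcd for a variable i; this exposes numerator i and denominator 1.
ι≡mkℚ : ∀ i → ι i ≡ mkℚ i 0 (Coprime.sym (Coprime.1-coprimeTo ℤ.∣ i ∣))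
ι≡mkℚ (+ n) = ℚ.normalize-coprime {n} {0} _
ι≡mkℚ -[1+ n ] = cong -_ (ℚ.normalize-coprime {suc n} {0} _)

ι-+ : ∀ i j → ι (i ℤ.+ j) ≡ ι i + ι j
ι-+ i j rewrite ι≡mkℚ i | ι≡mkℚ j =
  ℚ./-cong (sym (cong₂ ℤ._+_ (ℤ.*-identityʳ i) (ℤ.*-identityʳ j))) refl

ι-* : ∀ i j → ι (i ℤ.* j) ≡ ι i * ι j
ι-* i j rewrite ι≡mkℚ i | ι≡mkℚ j = refl

ℕtoℚ-+ : ∀ m n → ℕtoℚ (m ℕ.+ n) ≡ ℕtoℚ m + ℕtoℚ n
ℕtoℚ-+ m n = ι-+ (+ m) (+ n)

ℕtoℚ-* : ∀ m n → ℕtoℚ (m ℕ.* n) ≡ ℕtoℚ m * ℕtoℚ n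
ℕtoℚ-* m n = trans (cong ι (ℤ.pos-* m n)) (ι-* (+ m) (+ n))

*ι≡ι⇒↥*≡*↧ : ∀ x c d → x * ι c ≡ ι d → ↥ x ℤ.* c ≡ d ℤ.* ↧ x
*ι≡ι⇒↥*≡*↧ x c d eq = begin
  ↥ x ℤ.* c                    ≡⟨ cong (↥ x ℤ.*_) (sym (↥-ι c)) ⟩
  ↥ x ℤ.* ↥ ι c                ≡⟨ sym (ℚ.↥-* x (ι c)) ⟩
  ↥ (x * ι c) ℤ.* g            ≡⟨ cong (ℤ._* g) cross ⟩
  d ℤ.* ↧ (x * ι c) ℤ.* g      ≡⟨ ℤ.*-assoc d _ g ⟩
  d ℤ.* (↧ (x * ι c) ℤ.* g)    ≡⟨ cong (d ℤ.*_) (ℚ.↧-* x (ι c)) ⟩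
  d ℤ.* (↧ x ℤ.* ↧ ι c)        ≡⟨ cong (λ e → d ℤ.* (↧ x ℤ.* e)) (↧-ι c) ⟩
  d ℤ.* (↧ x ℤ.* + 1)          ≡⟨ cong (d ℤ.*_) (ℤ.*-identityʳ (↧ x)) ⟩
  d ℤ.* ↧ x                    ∎
  where
  open ≡-Reasoning
  g = ℤ.gcd (↥ x ℤ.* ↥ ι c) (↧ x ℤ.* ↧ ι c)
  ↥-ι : ∀ i → ↥ ι i ≡ i
  ↥-ι i = cong ↥_ (ι≡mkℚ i)
  ↧-ι : ∀ i → ↧ ι i ≡ + 1
  ↧-ι i = cong ↧_ (ι≡mkℚ i)
  cross : ↥ (x * ι c) ≡ d ℤ.* ↧ (x * ι c)
  cross = begin
    ↥ (x * ι c)                ≡⟨ sym (ℤ.*-identityʳ _) ⟩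
    ↥ (x * ι c) ℤ.* + 1        ≡⟨ cong (↥ (x * ι c) ℤ.*_) (sym (↧-ι d)) ⟩
    ↥ (x * ι c) ℤ.* ↧ ι d      ≡⟨ ℚ.drop-*≡* (ℚ.≡⇒≃ eq) ⟩
    ↥ ι d ℤ.* ↧ (x * ι c)      ≡⟨ cong (ℤ._* ↧ (x * ι c)) (↥-ι d) ⟩
    d ℤ.* ↧ (x * ι c)          ∎

1/m*m≡1 : ∀ j → (+ 1 ℚ./ suc j) * ℕtoℚ (suc j) ≡ 1ℚ
1/m*m≡1 j = begin
  (+ 1 ℚ./ suc j) * ℕtoℚ (suc j)       ≡⟨ cong₂ _*_ (ℚ.normalize-coprime {1} {j} c) (ι≡mkℚ (+ suc j)) ⟩
  mkℚ (+ 1) j c * mkℚ (+ suc j) 0 c′    ≡⟨ ℚ.*-inverseˡ (mkℚ (+ suc j) 0 c′) ⟩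
  1ℚ                                    ∎
  where
  open ≡-Reasoning
  c = Coprime.1-coprimeTo (suc j)
  c′ = Coprime.sym (Coprime.1-coprimeTo (suc j))

inverses-sum : ∀ x y m n → x * m ≡ 1ℚ → y * n ≡ 1ℚ → x + y ≡ (m + n) * x * y
inverses-sum x y m n xm≡1 yn≡1 = begin
  x + y                      ≡⟨ sym (cong₂ _+_ (trans (cong (x *_) yn≡1) (ℚ.*-identityʳ x))
                                                 (trans (cong (y *_) xm≡1) (ℚ.*-identityʳ y))) ⟩
  x * (y * n) + y * (x * m)  ≡⟨ shape x y m n ⟩
  (m + n) * x * y            ∎
  where
  open ≡-Reasoning
  shape : ∀ x y m n → x * (y * n) + y * (x * m) ≡ (m + n) * x * y
  shape = solve-∀ ℚ-ring

+-interchange : ∀ a b c d → a + b + (c + d) ≡ a + c + (b + d)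
+-interchange = solve-∀ ℚ-ring

powℚ-+ : ∀ x m n → powℚ x (m ℕ.+ n) ≡ powℚ x m * powℚ x n
powℚ-+ x zero    n = sym (ℚ.*-identityˡ (powℚ x n))
powℚ-+ x (suc m) n = trans (cong (x *_) (powℚ-+ x m n)) (sym (ℚ.*-assoc x (powℚ x m) (powℚ x n)))

signℚ-involutive : ∀ n → signℚ n * signℚ n ≡ 1ℚ
signℚ-involutive zero    = refl
signℚ-involutive (suc n) = trans (shape (signℚ n)) (signℚ-involutive n)
  where
  shape : ∀ σ → - 1ℚ * σ * (- 1ℚ * σ) ≡ σ * σ
  shape = solve-∀ ℚ-ring

sum-++ : ∀ xs ys → sumℚ (xs ++ ys) ≡ sumℚ xs + sumℚ ys
sum-++ []       ys = sym (ℚ.+-identityˡ (sumℚ ys))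
sum-++ (x ∷ xs) ys = trans (cong (_+_ x) (sum-++ xs ys)) (sym (ℚ.+-assoc x (sumℚ xs) (sumℚ ys)))

sum-map-*ˡ : ∀ {A : Set} c (f : A → ℚ) xs → sumℚ (map (λ x → c * f x) xs) ≡ c * sumℚ (map f xs)
sum-map-*ˡ c f []       = sym (ℚ.*-zeroʳ c)
sum-map-*ˡ c f (x ∷ xs) =
  trans (cong (_+_ (c * f x)) (sum-map-*ˡ c f xs)) (sym (ℚ.*-distribˡ-+ c (f x) _))

sum-map-linear : ∀ {A : Set} c d (f g : A → ℚ) xs →
  sumℚ (map (λ x → c * f x + d * g x) xs) ≡ c * sumℚ (map f xs) + d * sumℚ (map g xs)
sum-map-linear c d f g [] = sym (annihilate c d)
  where
  annihilate : ∀ c d → c * 0ℚ + d * 0ℚ ≡ 0ℚ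
  annihilate = solve-∀ ℚ-ring
sum-map-linear c d f g (x ∷ xs) =
  trans (cong (_+_ (c * f x + d * g x)) (sum-map-linear c d f g xs)) (shape c d (f x) (g x) _ _)
  where
  shape : ∀ c d a b A B → c * a + d * b + (c * A + d * B) ≡ c * (a + A) + d * (b + B)
  shape = solve-∀ ℚ-ring

sum-map-*-sub : ∀ {A : Set} (f g : A → ℚ) X xs →
  sumℚ (map (λ x → f x * (X - g x)) xs) ≡ sumℚ (map f xs) * X - sumℚ (map (λ x → f x * g x) xs)
sum-map-*-sub f g X []       = sym (annihilate X)
  where
  annihilate : ∀ X → 0ℚ * X - 0ℚ ≡ 0ℚ
  annihilate = solve-∀ ℚ-ring
sum-map-*-sub f g X (x ∷ xs) =
  trans (cong (_+_ (f x * (X - g x))) (sum-map-*-sub f g X xs)) (shape (f x) (g x) X _ _)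
  where
  shape : ∀ a b X A B → a * (X - b) + (A * X - B) ≡ (a + A) * X - (a * b + B)
  shape = solve-∀ ℚ-ring

sum-map-concatMap : ∀ {A B : Set} (f : B → ℚ) (g : A → List B) xs →
  sumℚ (map f (concatMap g xs)) ≡ sumℚ (map (λ x → sumℚ (map f (g x))) xs)
sum-map-concatMap f g []       = refl
sum-map-concatMap f g (x ∷ xs) = begin
  sumℚ (map f (g x ++ concatMap g xs))                  ≡⟨ cong sumℚ (List.map-++ f (g x) _) ⟩
  sumℚ (map f (g x) ++ map f (concatMap g xs))          ≡⟨ sum-++ (map f (g x)) _ ⟩
  sumℚ (map f (g x)) + sumℚ (map f (concatMap g xs))    ≡⟨ cong (_+_ (sumℚ (map f (g x)))) (sum-map-concatMap f g xs) ⟩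
  sumℚ (map f (g x)) + sumℚ (map (λ x → sumℚ (map f (g x))) xs) ∎
  where open ≡-Reasoning

sumBelow : (ℕ → ℚ) → ℕ → ℚ
sumBelow f n = sumℚ (map f (upTo n))

sumBelow-suc : ∀ f n → sumBelow f (suc n) ≡ f 0 + sumBelow (λ r → f (suc r)) n
sumBelow-suc f n =
  cong sumℚ (trans (List.map-upTo f (suc n)) (cong (f 0 ∷_) (sym (List.map-upTo (λ r → f (suc r)) n))))

length'≡length : ∀ xs → length' xs ≡ length xs
length'≡length []       = refl
length'≡length (x ∷ xs) = cong suc (length'≡length xs)

length'-map : ∀ (f : ℕ → ℕ) xs → length' (map f xs) ≡ length' xs
length'-map f []       = refl
length'-map f (x ∷ xs) = cong suc (length'-map f xs)

length'-reverse : ∀ xs → length' (reverse xs) ≡ length' xs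
length'-reverse xs = trans (length'≡length (reverse xs)) (trans (List.length-reverse xs) (sym (length'≡length xs)))

length'-zipWith : ∀ {f : ℕ → ℕ → ℕ} s r → length' r ≡ length' s → length' (zipWith f s r) ≡ length' s
length'-zipWith []      _       _      = refl
length'-zipWith (_ ∷ s) (_ ∷ r) |r|≡|s| = cong suc (length'-zipWith s r (ℕ.suc-injective |r|≡|s|))

zipWith-∷ʳ : ∀ {A B C : Set} (f : A → B → C) xs ys x y → length xs ≡ length ys →
  zipWith f (xs ∷ʳ x) (ys ∷ʳ y) ≡ zipWith f xs ys ∷ʳ f x y
zipWith-∷ʳ f []       []       x y _       = refl
zipWith-∷ʳ f (a ∷ xs) (b ∷ ys) x y |xs|≡|ys| = cong (f a b ∷_) (zipWith-∷ʳ f xs ys x y (ℕ.suc-injective |xs|≡|ys|))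

zipWith-reverse : ∀ {A B C : Set} (f : A → B → C) xs ys → length xs ≡ length ys →
  zipWith f (reverse xs) (reverse ys) ≡ reverse (zipWith f xs ys)
zipWith-reverse f []       []       _ = refl
zipWith-reverse f (x ∷ xs) (y ∷ ys) |xs|≡|ys| = begin
  zipWith f (reverse (x ∷ xs)) (reverse (y ∷ ys))   ≡⟨ cong₂ (zipWith f) (List.unfold-reverse x xs) (List.unfold-reverse y ys) ⟩
  zipWith f (reverse xs ∷ʳ x) (reverse ys ∷ʳ y)     ≡⟨ zipWith-∷ʳ f (reverse xs) (reverse ys) x y |rev| ⟩
  zipWith f (reverse xs) (reverse ys) ∷ʳ f x y      ≡⟨ cong (_∷ʳ f x y) (zipWith-reverse f xs ys |xs|≡|ys|′) ⟩
  reverse (zipWith f xs ys) ∷ʳ f x y                ≡⟨ sym (List.unfold-reverse (f x y) (zipWith f xs ys)) ⟩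
  reverse (zipWith f (x ∷ xs) (y ∷ ys))             ∎
  where
  open ≡-Reasoning
  |xs|≡|ys|′ = ℕ.suc-injective |xs|≡|ys|
  |rev| = trans (List.length-reverse xs) (trans |xs|≡|ys|′ (sym (List.length-reverse ys)))

prod-∷ʳ : ∀ xs x → prodℚ (xs ∷ʳ x) ≡ prodℚ xs * x
prod-∷ʳ []       x = trans (ℚ.*-identityʳ x) (sym (ℚ.*-identityˡ x))
prod-∷ʳ (y ∷ xs) x = trans (cong (y *_) (prod-∷ʳ xs x)) (sym (ℚ.*-assoc y (prodℚ xs) x))

prod-reverse : ∀ xs → prodℚ (reverse xs) ≡ prodℚ xs
prod-reverse []       = refl
prod-reverse (x ∷ xs) = begin
  prodℚ (reverse (x ∷ xs))   ≡⟨ cong prodℚ (List.unfold-reverse x xs) ⟩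
  prodℚ (reverse xs ∷ʳ x)    ≡⟨ prod-∷ʳ (reverse xs) x ⟩
  prodℚ (reverse xs) * x     ≡⟨ cong (_* x) (prod-reverse xs) ⟩
  prodℚ xs * x               ≡⟨ ℚ.*-comm (prodℚ xs) x ⟩
  x * prodℚ xs               ∎
  where open ≡-Reasoning

-- Multiple harmonic sums as sums over index sets

-- Sum of F J over the strictly decreasing lists J of length k with entries below n;
-- the entry j stands for the summation index j + 1, as in the recursion defining H.
subsetSum : ℕ → ℕ → (List ℕ → ℚ) → ℚ
subsetSum n       zero    F = F []
subsetSum zero    (suc k) F = 0ℚ
subsetSum (suc n) (suc k) F = subsetSum n k (λ J → F (n ∷ J)) + subsetSum n (suc k) F

subsetSum-cong : ∀ n k {F G : List ℕ → ℚ} →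
  (∀ J → length' J ≡ k → All (_< n) J → F J ≡ G J) → subsetSum n k F ≡ subsetSum n k G
subsetSum-cong n       zero    F≡G = F≡G [] refl All.[]
subsetSum-cong zero    (suc k) F≡G = refl
subsetSum-cong (suc n) (suc k) F≡G = cong₂ _+_
  (subsetSum-cong n k (λ J |J| J<n → F≡G (n ∷ J) (cong suc |J|) (ℕ.≤-refl All.∷ All.map ℕ.m≤n⇒m≤1+n J<n)))
  (subsetSum-cong n (suc k) (λ J |J| J<n → F≡G J |J| (All.map ℕ.m≤n⇒m≤1+n J<n)))

subsetSum-0ℚ : ∀ n k → subsetSum n k (λ _ → 0ℚ) ≡ 0ℚ
subsetSum-0ℚ n       zero    = refl
subsetSum-0ℚ zero    (suc k) = refl
subsetSum-0ℚ (suc n) (suc k) = cong₂ _+_ (subsetSum-0ℚ n k) (subsetSum-0ℚ n (suc k))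

subsetSum-+ : ∀ n k (F G : List ℕ → ℚ) → subsetSum n k (λ J → F J + G J) ≡ subsetSum n k F + subsetSum n k G
subsetSum-+ n       zero    F G = refl
subsetSum-+ zero    (suc k) F G = refl
subsetSum-+ (suc n) (suc k) F G =
  trans (cong₂ _+_ (subsetSum-+ n k (λ J → F (n ∷ J)) (λ J → G (n ∷ J))) (subsetSum-+ n (suc k) F G))
        (+-interchange (subsetSum n k (λ J → F (n ∷ J))) (subsetSum n k (λ J → G (n ∷ J)))
                       (subsetSum n (suc k) F) (subsetSum n (suc k) G))

subsetSum-*ˡ : ∀ n k c (F : List ℕ → ℚ) → subsetSum n k (λ J → c * F J) ≡ c * subsetSum n k F
subsetSum-*ˡ n       zero    c F = refl
subsetSum-*ˡ zero    (suc k) c F = sym (ℚ.*-zeroʳ c)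
subsetSum-*ˡ (suc n) (suc k) c F =
  trans (cong₂ _+_ (subsetSum-*ˡ n k c (λ J → F (n ∷ J))) (subsetSum-*ˡ n (suc k) c F)) (sym (ℚ.*-distribˡ-+ c _ _))

subsetSum-sub-* : ∀ n k c (F G : List ℕ → ℚ) →
  subsetSum n k (λ J → F J - c * G J) ≡ subsetSum n k F - c * subsetSum n k G
subsetSum-sub-* n k c F G = begin
  subsetSum n k (λ J → F J - c * G J)              ≡⟨ subsetSum-+ n k F _ ⟩
  subsetSum n k F + subsetSum n k (λ J → - (c * G J)) ≡⟨ cong (_+_ (subsetSum n k F)) (subsetSum-cong n k (λ J _ _ → negate c (G J))) ⟩
  subsetSum n k F + subsetSum n k (λ J → (- c) * G J) ≡⟨ cong (_+_ (subsetSum n k F)) (subsetSum-*ˡ n k (- c) G) ⟩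
  subsetSum n k F + (- c) * subsetSum n k G        ≡⟨ sym (cong (_+_ (subsetSum n k F)) (negate c (subsetSum n k G))) ⟩
  subsetSum n k F - c * subsetSum n k G            ∎
  where
  open ≡-Reasoning
  negate : ∀ c x → - (c * x) ≡ (- c) * x
  negate = solve-∀ ℚ-ring

subsetSum-sum : ∀ {A : Set} n k (G : A → List ℕ → ℚ) xs →
  subsetSum n k (λ J → sumℚ (map (λ x → G x J) xs)) ≡ sumℚ (map (λ x → subsetSum n k (G x)) xs)
subsetSum-sum n k G []       = subsetSum-0ℚ n k
subsetSum-sum n k G (x ∷ xs) =
  trans (subsetSum-+ n k (G x) _) (cong (_+_ (subsetSum n k (G x))) (subsetSum-sum n k G xs))

-- On summation indices this is m ↦ (n + 1) − m, i.e. m ↦ p − m for n = p − 1.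
reflect : ℕ → ℕ → ℕ
reflect n j = n ∸ suc j

subsetSum-lowest : ∀ n k F → subsetSum (suc n) (suc k) F ≡
  subsetSum n k (λ J → F (map suc J ∷ʳ 0)) + subsetSum n (suc k) (λ J → F (map suc J))
subsetSum-lowest zero    zero    F = refl
subsetSum-lowest zero    (suc k) F = refl
subsetSum-lowest (suc n) zero    F =
  trans (cong (_+_ (F (suc n ∷ []))) (subsetSum-lowest n zero F)) (shape (F (suc n ∷ [])) (F (0 ∷ [])) _)
  where
  shape : ∀ a b c → a + (b + c) ≡ b + (a + c)
  shape = solve-∀ ℚ-ring
subsetSum-lowest (suc n) (suc k) F =
  trans (cong₂ _+_ (subsetSum-lowest n k (λ J → F (suc n ∷ J))) (subsetSum-lowest n (suc k) F))
        (+-interchange (subsetSum n k (λ J → F (suc n ∷ map suc J ∷ʳ 0))) (subsetSum n (suc k) (λ J → F (suc n ∷ map suc J)))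
                       (subsetSum n (suc k) (λ J → F (map suc J ∷ʳ 0))) (subsetSum n (suc (suc k)) (λ J → F (map suc J))))

subsetSum-reflect : ∀ n k F → subsetSum n k F ≡ subsetSum n k (λ J → F (reverse (map (reflect n) J)))
subsetSum-reflect n       zero    F = refl
subsetSum-reflect zero    (suc k) F = refl
subsetSum-reflect (suc n) (suc k) F = sym (begin
  subsetSum (suc n) (suc k) (λ J → F (reverse (map (reflect (suc n)) J)))
    ≡⟨ subsetSum-lowest n k _ ⟩
  subsetSum n k (λ J → F (reverse (map (reflect (suc n)) (map suc J ∷ʳ 0)))) +
  subsetSum n (suc k) (λ J → F (reverse (map (reflect (suc n)) (map suc J))))
    ≡⟨ cong₂ _+_ (subsetSum-cong n k (λ J _ _ → cong F (reflect-∷ʳ J)))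
                 (subsetSum-cong n (suc k) (λ J _ _ → cong F (reflect-map-suc J))) ⟩
  subsetSum n k (λ J → F (n ∷ reverse (map (reflect n) J))) + subsetSum n (suc k) (λ J → F (reverse (map (reflect n) J)))
    ≡⟨ sym (cong₂ _+_ (subsetSum-reflect n k (λ J → F (n ∷ J))) (subsetSum-reflect n (suc k) F)) ⟩
  subsetSum (suc n) (suc k) F ∎)
  where
  open ≡-Reasoning
  reflect-map-suc : ∀ J → reverse (map (reflect (suc n)) (map suc J)) ≡ reverse (map (reflect n) J)
  reflect-map-suc J = cong reverse (sym (List.map-∘ J))
  reflect-∷ʳ : ∀ J → reverse (map (reflect (suc n)) (map suc J ∷ʳ 0)) ≡ n ∷ reverse (map (reflect n) J)
  reflect-∷ʳ J = begin
    reverse (map (reflect (suc n)) (map suc J ∷ʳ 0))      ≡⟨ cong reverse (List.map-++ (reflect (suc n)) (map suc J) (0 ∷ [])) ⟩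
    reverse (map (reflect (suc n)) (map suc J) ∷ʳ n)      ≡⟨ List.reverse-++ (map (reflect (suc n)) (map suc J)) (n ∷ []) ⟩
    n ∷ reverse (map (reflect (suc n)) (map suc J))       ≡⟨ cong (n ∷_) (reflect-map-suc J) ⟩
    n ∷ reverse (map (reflect n) J)                       ∎

monomial : List ℕ → List ℕ → ℚ
monomial e J = prodℚ (zipWith (λ ej j → invPow j ej) e J)

H≡subsetSum : ∀ n s → H n s ≡ subsetSum n (length' s) (monomial s)
H≡subsetSum n       []      = refl
H≡subsetSum zero    (e ∷ s) = refl
H≡subsetSum (suc n) (e ∷ s) =
  cong₂ _+_ (trans (cong (invPow n e *_) (H≡subsetSum n s)) (sym (subsetSum-*ˡ n (length' s) (invPow n e) (monomial s))))
            (H≡subsetSum n (e ∷ s))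

-- The r-th term of u^s (1 − p u)^(−s); for s = 0 truncated subtraction still yields C(r − 1, r).
negBinomialTerm : ℕ → ℚ → ℕ → ℕ → ℚ
negBinomialTerm p u s r = ℕtoℚ ((s ℕ.+ r ∸ 1) C r) * ℕtoℚ (p ^ r) * powℚ u (s ℕ.+ r)

coefficient : List ℕ → List ℕ → ℚ
coefficient s r = prodℚ (zipWith (λ sj rj → ℕtoℚ ((sj ℕ.+ rj ∸ 1) C rj)) s r)

summand : ℕ → List ℕ → List ℕ → List ℕ → ℚ
summand p s K r = coefficient s r * ℕtoℚ (p ^ sumℕ r) * monomial (zipWith ℕ._+_ s r) (map (reflect (p ∸ 1)) K)

truncatedExpansion : ℕ → List ℕ → List ℕ → ℕ → ℚ
truncatedExpansion p s K M = sumℚ (map (summand p s K) (tuples (length' s) M))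

summand-∷ : ∀ p s₀ s j₀ K r₀ r → summand p (s₀ ∷ s) (j₀ ∷ K) (r₀ ∷ r) ≡
  negBinomialTerm p (+ 1 ℚ./ suc (reflect (p ∸ 1) j₀)) s₀ r₀ * summand p s K r
summand-∷ p s₀ s j₀ K r₀ r =
  trans (cong (λ q → c₀ * coefficient s r * q * (U * monomial (zipWith ℕ._+_ s r) (map (reflect (p ∸ 1)) K)))
              (trans (cong ℕtoℚ (ℕ.^-distribˡ-+-* p r₀ (sumℕ r))) (ℕtoℚ-* (p ^ r₀) (p ^ sumℕ r))))
        (shape c₀ (coefficient s r) (ℕtoℚ (p ^ r₀)) (ℕtoℚ (p ^ sumℕ r)) U _)
  where
  c₀ = ℕtoℚ ((s₀ ℕ.+ r₀ ∸ 1) C r₀)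
  U = invPow (reflect (p ∸ 1) j₀) (s₀ ℕ.+ r₀)
  shape : ∀ c₀ c P₀ P U V → c₀ * c * (P₀ * P) * (U * V) ≡ c₀ * P₀ * U * (c * P * V)
  shape = solve-∀ ℚ-ring

truncatedExpansion-∷ : ∀ p s₀ s j₀ K M → truncatedExpansion p (s₀ ∷ s) (j₀ ∷ K) M ≡
  sumBelow (λ r₀ → negBinomialTerm p (+ 1 ℚ./ suc (reflect (p ∸ 1) j₀)) s₀ r₀ * truncatedExpansion p s K (M ∸ r₀)) (suc M)
truncatedExpansion-∷ p s₀ s j₀ K M =
  trans (sum-map-concatMap (summand p (s₀ ∷ s) (j₀ ∷ K)) (λ r₀ → map (r₀ ∷_) (tuples (length' s) (M ∸ r₀))) (upTo (suc M)))
        (cong sumℚ (List.map-cong inner (upTo (suc M))))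
  where
  inner : ∀ r₀ → sumℚ (map (summand p (s₀ ∷ s) (j₀ ∷ K)) (map (r₀ ∷_) (tuples (length' s) (M ∸ r₀)))) ≡
                 negBinomialTerm p (+ 1 ℚ./ suc (reflect (p ∸ 1) j₀)) s₀ r₀ * truncatedExpansion p s K (M ∸ r₀)
  inner r₀ = trans (cong sumℚ (trans (sym (List.map-∘ (tuples (length' s) (M ∸ r₀))))
                                     (List.map-cong (summand-∷ p s₀ s j₀ K r₀) (tuples (length' s) (M ∸ r₀)))))
                   (sum-map-*ˡ (negBinomialTerm p (+ 1 ℚ./ suc (reflect (p ∸ 1) j₀)) s₀ r₀) (summand p s K) (tuples (length' s) (M ∸ r₀)))

monomial-reverse : ∀ e J → length' e ≡ length' J → monomial (reverse e) (reverse J) ≡ monomial e J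
monomial-reverse e J |e|≡|J| = trans
  (cong prodℚ (zipWith-reverse (λ ej j → invPow j ej) e J
                 (trans (sym (length'≡length e)) (trans |e|≡|J| (length'≡length J)))))
  (prod-reverse (zipWith (λ ej j → invPow j ej) e J))

term≡subsetSum : ∀ p s r → length' r ≡ length' s →
  term p s r ≡ subsetSum (p ∸ 1) (length' s) (λ J → summand p s J r)
term≡subsetSum p s r |r|≡|s| = begin
  c * H n (reverse e)
    ≡⟨ cong (c *_) (H≡subsetSum n (reverse e)) ⟩
  c * subsetSum n (length' (reverse e)) (monomial (reverse e))
    ≡⟨ cong (λ m → c * subsetSum n m (monomial (reverse e))) (trans (length'-reverse e) |e|) ⟩
  c * subsetSum n k (monomial (reverse e))
    ≡⟨ cong (c *_) (subsetSum-reflect n k (monomial (reverse e))) ⟩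
  c * subsetSum n k (λ J → monomial (reverse e) (reverse (map (reflect n) J)))
    ≡⟨ cong (c *_) (subsetSum-cong n k (λ J |J| _ →
         monomial-reverse e (map (reflect n) J) (trans |e| (sym (trans (length'-map (reflect n) J) |J|))))) ⟩
  c * subsetSum n k (λ J → monomial e (map (reflect n) J))
    ≡⟨ sym (subsetSum-*ˡ n k c (λ J → monomial e (map (reflect n) J))) ⟩
  subsetSum n k (λ J → summand p s J r) ∎
  where
  open ≡-Reasoning
  n = p ∸ 1
  k = length' s
  e = zipWith ℕ._+_ s r
  |e| = length'-zipWith s r |r|≡|s|
  c = coefficient s r * ℕtoℚ (p ^ sumℕ r)

tuples-length : ∀ k M → All (λ r → length' r ≡ k) (tuples k M)
tuples-length zero    M = refl All.∷ All.[]
tuples-length (suc k) M = AllP.concat⁺ (AllP.map⁺ (All.universal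
  (λ r₀ → AllP.map⁺ (All.map (cong suc) (tuples-length k (M ∸ r₀)))) (upTo (suc M))))

partialSum≡subsetSum : ∀ p s M →
  partialSum p s M ≡ subsetSum (p ∸ 1) (length' s) (λ J → truncatedExpansion p s J M)
partialSum≡subsetSum p s M = trans
  (cong sumℚ (List.map-cong-local (All.map (term≡subsetSum p s _) (tuples-length (length' s) M))))
  (sym (subsetSum-sum (p ∸ 1) (length' s) (λ r J → summand p s J r) (tuples (length' s) M)))

-- p-adic valuation

record Integral (p : ℕ) (x : ℚ) : Set where
  constructor mkIntegral
  field
    numerator     : ℤ
    denominator   : ℕ
    p∤denominator : ¬ p ∣ denominator
    cleared       : x * ℕtoℚ denominator ≡ ι numerator

record ValuationAtLeast (p n : ℕ) (x : ℚ) : Set where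
  constructor mkValuation
  field
    cofactor          : ℚ
    cofactor-integral : Integral p cofactor
    factored          : x ≡ ℕtoℚ (p ^ n) * cofactor

module Valuation {p : ℕ} (p-prime : Prime p) where

  p∤1 : ¬ p ∣ 1
  p∤1 p∣1 = ¬prime[1] (subst Prime (ℕ.∣1⇒≡1 p∣1) p-prime)

  p∤* : ∀ {b c} → ¬ p ∣ b → ¬ p ∣ c → ¬ p ∣ b ℕ.* c
  p∤* {b} {c} p∤b p∤c p∣bc with euclidsLemma b c p-prime p∣bc
  ... | inj₁ p∣b = p∤b p∣b
  ... | inj₂ p∣c = p∤c p∣c

  integral-ι : ∀ a → Integral p (ι a)
  integral-ι a = mkIntegral a 1 p∤1 (ℚ.*-identityʳ (ι a))

  integral-+ : ∀ {x y} → Integral p x → Integral p y → Integral p (x + y)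
  integral-+ {x} {y} (mkIntegral a b p∤b xb≡a) (mkIntegral c d p∤d yd≡c) =
    mkIntegral (a ℤ.* + d ℤ.+ c ℤ.* + b) (b ℕ.* d) (p∤* p∤b p∤d) (begin
      (x + y) * ℕtoℚ (b ℕ.* d)                   ≡⟨ cong ((x + y) *_) (ℕtoℚ-* b d) ⟩
      (x + y) * (ℕtoℚ b * ℕtoℚ d)                ≡⟨ expand x y (ℕtoℚ b) (ℕtoℚ d) ⟩
      x * ℕtoℚ b * ℕtoℚ d + y * ℕtoℚ d * ℕtoℚ b  ≡⟨ cong₂ (λ u v → u * ℕtoℚ d + v * ℕtoℚ b) xb≡a yd≡c ⟩
      ι a * ℕtoℚ d + ι c * ℕtoℚ b                ≡⟨ sym (cong₂ _+_ (ι-* a (+ d)) (ι-* c (+ b))) ⟩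
      ι (a ℤ.* + d) + ι (c ℤ.* + b)              ≡⟨ sym (ι-+ (a ℤ.* + d) (c ℤ.* + b)) ⟩
      ι (a ℤ.* + d ℤ.+ c ℤ.* + b)                ∎)
    where
    open ≡-Reasoning
    expand : ∀ x y b d → (x + y) * (b * d) ≡ x * b * d + y * d * b
    expand = solve-∀ ℚ-ring

  integral-* : ∀ {x y} → Integral p x → Integral p y → Integral p (x * y)
  integral-* {x} {y} (mkIntegral a b p∤b xb≡a) (mkIntegral c d p∤d yd≡c) =
    mkIntegral (a ℤ.* c) (b ℕ.* d) (p∤* p∤b p∤d) (begin
      x * y * ℕtoℚ (b ℕ.* d)                 ≡⟨ cong (x * y *_) (ℕtoℚ-* b d) ⟩
      x * y * (ℕtoℚ b * ℕtoℚ d)              ≡⟨ regroup x y (ℕtoℚ b) (ℕtoℚ d) ⟩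
      (x * ℕtoℚ b) * (y * ℕtoℚ d)            ≡⟨ cong₂ _*_ xb≡a yd≡c ⟩
      ι a * ι c                              ≡⟨ sym (ι-* a c) ⟩
      ι (a ℤ.* c)                            ∎)
    where
    open ≡-Reasoning
    regroup : ∀ x y b d → x * y * (b * d) ≡ (x * b) * (y * d)
    regroup = solve-∀ ℚ-ring

  integral-neg : ∀ {x} → Integral p x → Integral p (- x)
  integral-neg {x} ix =
    subst (Integral p) (trans (sym (ℚ.neg-distribˡ-* 1ℚ x)) (cong -_ (ℚ.*-identityˡ x)))
      (integral-* (integral-ι (ℤ.- + 1)) ix)

  integral⇒valuation0 : ∀ {x} → Integral p x → ValuationAtLeast p 0 x
  integral⇒valuation0 {x} ix = mkValuation x ix (sym (ℚ.*-identityˡ x))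

  valuation-ι : ∀ a → ValuationAtLeast p 0 (ι a)
  valuation-ι a = integral⇒valuation0 (integral-ι a)

  valuation-pⁿ : ∀ n → ValuationAtLeast p n (ℕtoℚ (p ^ n))
  valuation-pⁿ n = mkValuation 1ℚ (integral-ι (+ 1)) (sym (ℚ.*-identityʳ (ℕtoℚ (p ^ n))))

  valuation-0ℚ : ∀ {n} → ValuationAtLeast p n 0ℚ
  valuation-0ℚ {n} = mkValuation 0ℚ (integral-ι (+ 0)) (sym (ℚ.*-zeroʳ (ℕtoℚ (p ^ n))))

  valuation-+ : ∀ {n x y} → ValuationAtLeast p n x → ValuationAtLeast p n y →
                ValuationAtLeast p n (x + y)
  valuation-+ {n} (mkValuation a ia x≡) (mkValuation b ib y≡) =
    mkValuation (a + b) (integral-+ ia ib) (trans (cong₂ _+_ x≡ y≡) (sym (ℚ.*-distribˡ-+ (ℕtoℚ (p ^ n)) a b)))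

  valuation-neg : ∀ {n x} → ValuationAtLeast p n x → ValuationAtLeast p n (- x)
  valuation-neg {n} (mkValuation a ia x≡) =
    mkValuation (- a) (integral-neg ia) (trans (cong -_ x≡) (ℚ.neg-distribʳ-* (ℕtoℚ (p ^ n)) a))

  valuation-sub : ∀ {n x y} → ValuationAtLeast p n x → ValuationAtLeast p n y →
                ValuationAtLeast p n (x - y)
  valuation-sub vx vy = valuation-+ vx (valuation-neg vy)

  valuation-* : ∀ {m n x y} → ValuationAtLeast p m x → ValuationAtLeast p n y →
                ValuationAtLeast p (m ℕ.+ n) (x * y)
  valuation-* {m} {n} {x} {y} (mkValuation a ia x≡) (mkValuation b ib y≡) =
    mkValuation (a * b) (integral-* ia ib) (begin
      x * y                                   ≡⟨ cong₂ _*_ x≡ y≡ ⟩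
      ℕtoℚ (p ^ m) * a * (ℕtoℚ (p ^ n) * b)   ≡⟨ regroup (ℕtoℚ (p ^ m)) a (ℕtoℚ (p ^ n)) b ⟩
      ℕtoℚ (p ^ m) * ℕtoℚ (p ^ n) * (a * b)   ≡⟨ cong (_* (a * b)) (sym (ℕtoℚ-* (p ^ m) (p ^ n))) ⟩
      ℕtoℚ (p ^ m ℕ.* p ^ n) * (a * b)        ≡⟨ cong (λ k → ℕtoℚ k * (a * b)) (sym (ℕ.^-distribˡ-+-* p m n)) ⟩
      ℕtoℚ (p ^ (m ℕ.+ n)) * (a * b)          ∎)
    where
    open ≡-Reasoning
    regroup : ∀ P a Q b → P * a * (Q * b) ≡ P * Q * (a * b)
    regroup = solve-∀ ℚ-ring

  valuation-weaken : ∀ {m n x} → m ≤ n → ValuationAtLeast p n x → ValuationAtLeast p m x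
  valuation-weaken {m} {n} {x} m≤n (mkValuation a ia x≡) =
    mkValuation (ℕtoℚ (p ^ (n ∸ m)) * a) (integral-* (integral-ι (+ (p ^ (n ∸ m)))) ia) (begin
      x                                                 ≡⟨ x≡ ⟩
      ℕtoℚ (p ^ n) * a                                  ≡⟨ cong (λ k → ℕtoℚ (p ^ k) * a) (sym (ℕ.m+[n∸m]≡n m≤n)) ⟩
      ℕtoℚ (p ^ (m ℕ.+ (n ∸ m))) * a                    ≡⟨ cong (λ k → ℕtoℚ k * a) (ℕ.^-distribˡ-+-* p m (n ∸ m)) ⟩
      ℕtoℚ (p ^ m ℕ.* p ^ (n ∸ m)) * a                  ≡⟨ cong (_* a) (ℕtoℚ-* (p ^ m) _) ⟩
      ℕtoℚ (p ^ m) * ℕtoℚ (p ^ (n ∸ m)) * a             ≡⟨ ℚ.*-assoc (ℕtoℚ (p ^ m)) _ a ⟩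
      ℕtoℚ (p ^ m) * (ℕtoℚ (p ^ (n ∸ m)) * a)           ∎)
    where open ≡-Reasoning

  p^n∣m*b⇒p^n∣m : ∀ n m {b} → ¬ p ∣ b → p ^ n ∣ m ℕ.* b → p ^ n ∣ m
  p^n∣m*b⇒p^n∣m zero m p∤b _ = ℕ.1∣ m
  p^n∣m*b⇒p^n∣m (suc n) m {b} p∤b p^[1+n]∣mb
    with euclidsLemma m b p-prime (ℕ.∣-trans (ℕ.m∣m*n (p ^ n)) p^[1+n]∣mb)
  ... | inj₂ p∣b = ⊥-elim (p∤b p∣b)
  ... | inj₁ (divides q refl) =
    subst (p ℕ.* p ^ n ∣_) (ℕ.*-comm p q) (ℕ.*-monoʳ-∣ p (p^n∣m*b⇒p^n∣m n q p∤b p^n∣qb))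
    where
    instance _ = prime⇒nonZero p-prime
    p^n∣qb : p ^ n ∣ q ℕ.* b
    p^n∣qb = ℕ.*-cancelˡ-∣ p (subst (p ℕ.* p ^ n ∣_)
      (trans (cong (ℕ._* b) (ℕ.*-comm q p)) (ℕ.*-assoc p q b)) p^[1+n]∣mb)

  valuation⇒padicClose : ∀ {n x y} → ValuationAtLeast p n (x - y) → padicClose p n x y
  valuation⇒padicClose {n} {x} {y} (mkValuation w (mkIntegral a b p∤b wb≡a) z≡) =
    p^n∣m*b⇒p^n∣m n ℤ.∣ ↥ z ∣ p∤b (subst (p ^ n ∣_) (sym ∣↥z∣b≡) (ℕ.∣m⇒∣m*n _ (ℕ.∣m⇒∣m*n _ ℕ.∣-refl)))
    where
    open ≡-Reasoning
    z = x - y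
    P = ℕtoℚ (p ^ n)
    zb≡ : z * ℕtoℚ b ≡ ι (+ (p ^ n) ℤ.* a)
    zb≡ = begin
      z * ℕtoℚ b          ≡⟨ cong (_* ℕtoℚ b) z≡ ⟩
      P * w * ℕtoℚ b      ≡⟨ ℚ.*-assoc P w (ℕtoℚ b) ⟩
      P * (w * ℕtoℚ b)    ≡⟨ cong (P *_) wb≡a ⟩
      P * ι a             ≡⟨ sym (ι-* (+ (p ^ n)) a) ⟩
      ι (+ (p ^ n) ℤ.* a) ∎
    ∣↥z∣b≡ : ℤ.∣ ↥ z ∣ ℕ.* b ≡ p ^ n ℕ.* ℤ.∣ a ∣ ℕ.* ℤ.∣ ↧ z ∣
    ∣↥z∣b≡ = begin
      ℤ.∣ ↥ z ∣ ℕ.* b                              ≡⟨ sym (ℤ.abs-* (↥ z) (+ b)) ⟩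
      ℤ.∣ ↥ z ℤ.* + b ∣                            ≡⟨ cong ℤ.∣_∣ (*ι≡ι⇒↥*≡*↧ z (+ b) (+ (p ^ n) ℤ.* a) zb≡) ⟩
      ℤ.∣ + (p ^ n) ℤ.* a ℤ.* ↧ z ∣                ≡⟨ ℤ.abs-* (+ (p ^ n) ℤ.* a) (↧ z) ⟩
      ℤ.∣ + (p ^ n) ℤ.* a ∣ ℕ.* ℤ.∣ ↧ z ∣          ≡⟨ cong (ℕ._* ℤ.∣ ↧ z ∣) (ℤ.abs-* (+ (p ^ n)) a) ⟩
      p ^ n ℕ.* ℤ.∣ a ∣ ℕ.* ℤ.∣ ↧ z ∣              ∎

  valuation-reindex : ∀ {m n x} → m ≡ n → ValuationAtLeast p m x → ValuationAtLeast p n x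
  valuation-reindex refl vx = vx

  valuation-p : ValuationAtLeast p 1 (ℕtoℚ p)
  valuation-p = subst (λ q → ValuationAtLeast p 1 (ℕtoℚ q)) (ℕ.*-identityʳ p) (valuation-pⁿ 1)

  valuation-1/ : ∀ j → ¬ p ∣ suc j → ValuationAtLeast p 0 (+ 1 ℚ./ suc j)
  valuation-1/ j p∤ = integral⇒valuation0 (mkIntegral (+ 1) (suc j) p∤ (1/m*m≡1 j))

  valuation-powℚ : ∀ {x} k → ValuationAtLeast p 0 x → ValuationAtLeast p 0 (powℚ x k)
  valuation-powℚ zero    vx = valuation-ι (+ 1)
  valuation-powℚ (suc k) vx = valuation-* vx (valuation-powℚ k vx)

  valuation-signℚ : ∀ k → ValuationAtLeast p 0 (signℚ k)
  valuation-signℚ k = valuation-powℚ k (valuation-ι (ℤ.- + 1))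

  valuation-sumBelow : ∀ {N} f n → (∀ {r} → r < n → ValuationAtLeast p N (f r)) →
                       ValuationAtLeast p N (sumBelow f n)
  valuation-sumBelow f zero    vf = valuation-0ℚ
  valuation-sumBelow f (suc n) vf =
    subst (ValuationAtLeast p _) (sym (sumBelow-suc f n))
      (valuation-+ (vf (s≤s z≤n)) (valuation-sumBelow (λ r → f (suc r)) n (λ r<n → vf (s≤s r<n))))

  valuation-subsetSum : ∀ {N} n k {F} → (∀ J → length' J ≡ k → All (_< n) J → ValuationAtLeast p N (F J)) →
                        ValuationAtLeast p N (subsetSum n k F)
  valuation-subsetSum n       zero    vF = vF [] refl All.[]
  valuation-subsetSum zero    (suc k) vF = valuation-0ℚ
  valuation-subsetSum (suc n) (suc k) vF = valuation-+
    (valuation-subsetSum n k (λ J |J| J<n → vF (n ∷ J) (cong suc |J|) (ℕ.≤-refl All.∷ All.map ℕ.m≤n⇒m≤1+n J<n)))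
    (valuation-subsetSum n (suc k) (λ J |J| J<n → vF J |J| (All.map ℕ.m≤n⇒m≤1+n J<n)))

  valuation-negBinomialTerm : ∀ {u} → ValuationAtLeast p 0 u → ∀ s r →
                              ValuationAtLeast p r (negBinomialTerm p u s r)
  valuation-negBinomialTerm vu s r =
    valuation-reindex (ℕ.+-identityʳ r)
      (valuation-* (valuation-* (valuation-ι (+ ((s ℕ.+ r ∸ 1) C r))) (valuation-pⁿ r)) (valuation-powℚ (s ℕ.+ r) vu))

  module NegativeBinomial {u w : ℚ} (vu : ValuationAtLeast p 0 u) (vw : ValuationAtLeast p 0 w)
                          (u+w≡puw : u + w ≡ ℕtoℚ p * u * w) where

    private
      P = ℕtoℚ p
      a = negBinomialTerm p u

    signedPower : ℕ → ℚ
    signedPower s = signℚ s * powℚ w s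

    signedPower-suc : ∀ s → signedPower (suc s) ≡ u * signedPower s + P * u * signedPower (suc s)
    signedPower-suc s = begin
      - 1ℚ * σ * (w * W)                             ≡⟨ shape u w P σ W ⟩
      R - σ * W * (u + w - P * u * w)                ≡⟨ cong (λ t → R - σ * W * (t - P * u * w)) u+w≡puw ⟩
      R - σ * W * (P * u * w - P * u * w)            ≡⟨ cancel R (σ * W) (P * u * w) ⟩
      R                                              ∎
      where
      open ≡-Reasoning
      σ = signℚ s
      W = powℚ w s
      R = u * (σ * W) + P * u * (- 1ℚ * σ * (w * W))
      shape : ∀ u w P σ W → - 1ℚ * σ * (w * W) ≡
                u * (σ * W) + P * u * (- 1ℚ * σ * (w * W)) - σ * W * (u + w - P * u * w)
      shape = solve-∀ ℚ-ring
      cancel : ∀ A B C → A - B * (C - C) ≡ A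
      cancel = solve-∀ ℚ-ring

    a-zero : ∀ r → a 0 (suc r) ≡ 0ℚ
    a-zero r rewrite k>n⇒nCk≡0 (ℕ.n<1+n r) =
      trans (cong (_* powℚ u (suc r)) (ℚ.*-zeroˡ (ℕtoℚ (p ^ suc r)))) (ℚ.*-zeroˡ (powℚ u (suc r)))

    a-suc-zero : ∀ s → a (suc s) 0 ≡ u * a s 0
    a-suc-zero s = shape u (powℚ u (s ℕ.+ 0))
      where
      shape : ∀ u U → 1ℚ * 1ℚ * (u * U) ≡ u * (1ℚ * 1ℚ * U)
      shape = solve-∀ ℚ-ring

    a-pascal : ∀ s r → a (suc s) (suc r) ≡ u * a s (suc r) + P * u * a (suc s) r
    a-pascal s r
      rewrite ℕ.+-suc s r | sym (nCk+nC[k+1]≡[n+1]C[k+1] (s ℕ.+ r) r)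
            | ℕtoℚ-+ ((s ℕ.+ r) C r) ((s ℕ.+ r) C suc r) | ℕtoℚ-* p (p ^ r) =
      shape (ℕtoℚ ((s ℕ.+ r) C r)) (ℕtoℚ ((s ℕ.+ r) C suc r)) P (ℕtoℚ (p ^ r)) u (powℚ u (s ℕ.+ r))
      where
      shape : ∀ c₀ c₁ P Q u U → (c₀ + c₁) * (P * Q) * (u * (u * U)) ≡
                u * (c₁ * (P * Q) * (u * U)) + P * u * (c₀ * Q * (u * U))
      shape = solve-∀ ℚ-ring

    sum-a-suc : ∀ s N → sumBelow (a (suc s)) (suc N) ≡
                        u * sumBelow (a s) (suc N) + P * u * sumBelow (a (suc s)) N
    sum-a-suc s N = begin
      sumBelow (a (suc s)) (suc N)
        ≡⟨ sumBelow-suc (a (suc s)) N ⟩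
      a (suc s) 0 + sumBelow (λ r → a (suc s) (suc r)) N
        ≡⟨ cong₂ _+_ (a-suc-zero s) (cong sumℚ (List.map-cong (a-pascal s) (upTo N))) ⟩
      u * a s 0 + sumBelow (λ r → u * a s (suc r) + P * u * a (suc s) r) N
        ≡⟨ cong (_+_ (u * a s 0)) (sum-map-linear u (P * u) (λ r → a s (suc r)) (a (suc s)) (upTo N)) ⟩
      u * a s 0 + (u * sumBelow (λ r → a s (suc r)) N + P * u * sumBelow (a (suc s)) N)
        ≡⟨ regroup u (a s 0) _ (P * u) _ ⟩
      u * (a s 0 + sumBelow (λ r → a s (suc r)) N) + P * u * sumBelow (a (suc s)) N
        ≡⟨ cong (λ t → u * t + P * u * sumBelow (a (suc s)) N) (sym (sumBelow-suc (a s) N)) ⟩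
      u * sumBelow (a s) (suc N) + P * u * sumBelow (a (suc s)) N
        ∎
      where
      open ≡-Reasoning
      regroup : ∀ u A B c C → u * A + (u * B + c * C) ≡ u * (A + B) + c * C
      regroup = solve-∀ ℚ-ring

    error-suc : ∀ s N →
      signedPower (suc s) - sumBelow (a (suc s)) (suc N) ≡
      u * (signedPower s - sumBelow (a s) (suc N)) + P * u * (signedPower (suc s) - sumBelow (a (suc s)) N)
    error-suc s N = begin
      signedPower (suc s) - sumBelow (a (suc s)) (suc N)
        ≡⟨ cong₂ _-_ (signedPower-suc s) (sum-a-suc s N) ⟩
      (u * signedPower s + P * u * signedPower (suc s)) - (u * sumBelow (a s) (suc N) + P * u * sumBelow (a (suc s)) N)
        ≡⟨ regroup u (signedPower s) (P * u) (signedPower (suc s)) _ _ ⟩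
      u * (signedPower s - sumBelow (a s) (suc N)) + P * u * (signedPower (suc s) - sumBelow (a (suc s)) N)
        ∎
      where
      open ≡-Reasoning
      regroup : ∀ u y c y′ A B → (u * y + c * y′) - (u * A + c * B) ≡ u * (y - A) + c * (y′ - B)
      regroup = solve-∀ ℚ-ring

    error-zero : ∀ N → signedPower 0 - sumBelow (a 0) (suc N) ≡ - sumBelow (λ r → a 0 (suc r)) N
    error-zero N = trans (cong (_-_ (signedPower 0)) (sumBelow-suc (a 0) N)) (shape _)
      where
      shape : ∀ S → 1ℚ * 1ℚ - (1ℚ * 1ℚ * 1ℚ + S) ≡ - S
      shape = solve-∀ ℚ-ring

    -- Both signedPower and (Pascal's rule) the partial sums satisfy f (s + 1) = u f s + p u f (s + 1),
    -- so the truncation error gains a factor p each time N grows.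
    truncation : ∀ s N → ValuationAtLeast p N (signedPower s - sumBelow (a s) N)
    truncation s zero =
      valuation-sub (valuation-* (valuation-signℚ s) (valuation-powℚ s vw)) valuation-0ℚ
    truncation zero (suc N) =
      subst (ValuationAtLeast p (suc N)) (sym (error-zero N))
        (valuation-neg (valuation-sumBelow _ N (λ {r} _ → subst (ValuationAtLeast p (suc N)) (sym (a-zero r)) valuation-0ℚ)))
    truncation (suc s) (suc N) =
      subst (ValuationAtLeast p (suc N)) (sym (error-suc s N))
        (valuation-+ (valuation-* vu (truncation s (suc N)))
                     (valuation-* (valuation-* valuation-p vu) (truncation (suc s) N)))

  cauchyProduct : ∀ {x X} (a S : ℕ → ℚ) →
    (∀ r → ValuationAtLeast p r (a r)) →
    (∀ M → ValuationAtLeast p M (x - sumBelow a M)) →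
    ValuationAtLeast p 0 X →
    (∀ M → ValuationAtLeast p (suc M) (X - S M)) →
    ∀ M → ValuationAtLeast p (suc M) (x * X - sumBelow (λ r → a r * S (M ∸ r)) (suc M))
  cauchyProduct {x} {X} a S va vx vX vS M =
    subst (ValuationAtLeast p (suc M)) (sym split)
      (valuation-+ (valuation-reindex (ℕ.+-identityʳ (suc M)) (valuation-* (vx (suc M)) vX))
                   (valuation-sumBelow _ (suc M) vterm))
    where
    open ≡-Reasoning
    rs = upTo (suc M)
    A = sumBelow a (suc M)
    T = sumBelow (λ r → a r * S (M ∸ r)) (suc M)
    vterm : ∀ {r} → r < suc M → ValuationAtLeast p (suc M) (a r * (X - S (M ∸ r)))
    vterm {r} (s≤s r≤M) =
      valuation-reindex (trans (ℕ.+-suc r (M ∸ r)) (cong suc (ℕ.m+[n∸m]≡n r≤M)))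
        (valuation-* (va r) (vS (M ∸ r)))
    split : x * X - T ≡ (x - A) * X + sumBelow (λ r → a r * (X - S (M ∸ r))) (suc M)
    split = begin
      x * X - T                   ≡⟨ shape x X A T ⟩
      (x - A) * X + (A * X - T)   ≡⟨ cong (_+_ ((x - A) * X)) (sym (sum-map-*-sub a (λ r → S (M ∸ r)) X rs)) ⟩
      (x - A) * X + sumBelow (λ r → a r * (X - S (M ∸ r))) (suc M) ∎
      where
      shape : ∀ x X A T → x * X - T ≡ (x - A) * X + (A * X - T)
      shape = solve-∀ ℚ-ring

-- The expansion of H_{p−1}

module Expansion {p : ℕ} (p-prime : Prime p) where

  open Valuation p-prime

  p∤-summand : ∀ {a b} → suc a ℕ.+ b ≡ p → 0 < b → ¬ p ∣ suc a
  p∤-summand {a} {b} a+b≡p 0<b p∣1+a =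
    ℕ.<⇒≱ (subst (suc a <_) a+b≡p (ℕ.m<m+n (suc a) 0<b)) (ℕ.∣⇒≤ p∣1+a)

  index+reflect≡p : ∀ {j} → j < p ∸ 1 → suc j ℕ.+ suc (reflect (p ∸ 1) j) ≡ p
  index+reflect≡p {j} j<n = begin
    suc j ℕ.+ suc (p ∸ 1 ∸ suc j)     ≡⟨ ℕ.+-suc (suc j) _ ⟩
    suc (suc j ℕ.+ (p ∸ 1 ∸ suc j))   ≡⟨ cong suc (ℕ.m+[n∸m]≡n j<n) ⟩
    suc (p ∸ 1)                       ≡⟨ ℕ.m+[n∸m]≡n (ℕ.>-nonZero⁻¹ p {{prime⇒nonZero p-prime}}) ⟩
    p                                 ∎
    where open ≡-Reasoning

  valuation-1/index : ∀ {j} → j < p ∸ 1 → ValuationAtLeast p 0 (+ 1 ℚ./ suc j)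
  valuation-1/index {j} j<n = valuation-1/ j (p∤-summand (index+reflect≡p j<n) (s≤s z≤n))

  valuation-1/reflect : ∀ {j} → j < p ∸ 1 → ValuationAtLeast p 0 (+ 1 ℚ./ suc (reflect (p ∸ 1) j))
  valuation-1/reflect {j} j<n =
    valuation-1/ _ (p∤-summand (trans (ℕ.+-comm _ (suc j)) (index+reflect≡p j<n)) (s≤s z≤n))

  valuation-monomial : ∀ e K → All (_< p ∸ 1) K → ValuationAtLeast p 0 (monomial e K)
  valuation-monomial []       _       _              = valuation-ι (+ 1)
  valuation-monomial (_ ∷ _)  []      _              = valuation-ι (+ 1)
  valuation-monomial (e ∷ es) (j ∷ K) (j<n All.∷ K<n) =
    valuation-* (valuation-powℚ e (valuation-1/index j<n)) (valuation-monomial es K K<n)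

  expansion-1/index : ∀ {j} → j < p ∸ 1 → ∀ s N →
    ValuationAtLeast p N (invPow j s - sumBelow (λ r → signℚ s * negBinomialTerm p (+ 1 ℚ./ suc (reflect (p ∸ 1) j)) s r) N)
  expansion-1/index {j} j<n s N =
    subst (ValuationAtLeast p N) unsign (valuation-* (valuation-signℚ s) (truncation s N))
    where
    open ≡-Reasoning
    u = + 1 ℚ./ suc (reflect (p ∸ 1) j)
    w = + 1 ℚ./ suc j
    m = suc (reflect (p ∸ 1) j)
    u+w≡puw : u + w ≡ ℕtoℚ p * u * w
    u+w≡puw = trans (inverses-sum u w (ℕtoℚ m) (ℕtoℚ (suc j)) (1/m*m≡1 (reflect (p ∸ 1) j)) (1/m*m≡1 j))
      (cong (λ c → c * u * w) (trans (sym (ℕtoℚ-+ m (suc j)))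
                                      (cong ℕtoℚ (trans (ℕ.+-comm m (suc j)) (index+reflect≡p j<n)))))
    open NegativeBinomial (valuation-1/reflect j<n) (valuation-1/index j<n) u+w≡puw
    σ = signℚ s
    A = sumBelow (negBinomialTerm p u s) N
    unsign : σ * (σ * powℚ w s - A) ≡ invPow j s - sumBelow (λ r → σ * negBinomialTerm p u s r) N
    unsign = begin
      σ * (σ * powℚ w s - A)         ≡⟨ shape σ (powℚ w s) A ⟩
      σ * σ * powℚ w s - σ * A       ≡⟨ cong₂ (λ c t → c * powℚ w s - t) (signℚ-involutive s)
                                               (sym (sum-map-*ˡ σ (negBinomialTerm p u s) (upTo N))) ⟩
      1ℚ * powℚ w s - σA             ≡⟨ cong (_- σA) (ℚ.*-identityˡ (powℚ w s)) ⟩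
      invPow j s - σA                ∎
      where
      σA = sumBelow (λ r → σ * negBinomialTerm p u s r) N
      shape : ∀ σ W A → σ * (σ * W - A) ≡ σ * σ * W - σ * A
      shape = solve-∀ ℚ-ring

  product-expansion : ∀ s K → length' K ≡ length' s → All (_< p ∸ 1) K → ∀ M →
    ValuationAtLeast p (suc M) (monomial s K - signℚ (sumℕ s) * truncatedExpansion p s K M)
  product-expansion []       []       _       _                  M = valuation-0ℚ
  product-expansion (s₀ ∷ s) (j₀ ∷ K) |K|≡|s| (j₀<n All.∷ K<n) M =
    subst (ValuationAtLeast p (suc M)) (cong (_-_ (monomial (s₀ ∷ s) (j₀ ∷ K))) (sym regroup))
      (cauchyProduct {invPow j₀ s₀} a S
        (λ r → valuation-* (valuation-signℚ s₀) (valuation-negBinomialTerm (valuation-1/reflect j₀<n) s₀ r))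
        (expansion-1/index j₀<n s₀) (valuation-monomial s K K<n)
        (product-expansion s K (ℕ.suc-injective |K|≡|s|) K<n) M)
    where
    open ≡-Reasoning
    t = negBinomialTerm p (+ 1 ℚ./ suc (reflect (p ∸ 1) j₀)) s₀
    σ₀ = signℚ s₀
    σ = signℚ (sumℕ s)
    T = truncatedExpansion p s K
    a : ℕ → ℚ
    a r = σ₀ * t r
    S : ℕ → ℚ
    S M = σ * T M
    regroup : signℚ (s₀ ℕ.+ sumℕ s) * truncatedExpansion p (s₀ ∷ s) (j₀ ∷ K) M ≡
              sumBelow (λ r → a r * S (M ∸ r)) (suc M)
    regroup = begin
      signℚ (s₀ ℕ.+ sumℕ s) * truncatedExpansion p (s₀ ∷ s) (j₀ ∷ K) M
        ≡⟨ cong₂ _*_ (powℚ-+ (- 1ℚ) s₀ (sumℕ s)) (truncatedExpansion-∷ p s₀ s j₀ K M) ⟩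
      σ₀ * σ * sumBelow (λ r → t r * T (M ∸ r)) (suc M)
        ≡⟨ sym (sum-map-*ˡ (σ₀ * σ) (λ r → t r * T (M ∸ r)) (upTo (suc M))) ⟩
      sumBelow (λ r → σ₀ * σ * (t r * T (M ∸ r))) (suc M)
        ≡⟨ cong sumℚ (List.map-cong (λ r → shape σ₀ σ (t r) (T (M ∸ r))) (upTo (suc M))) ⟩
      sumBelow (λ r → a r * S (M ∸ r)) (suc M) ∎
      where
      shape : ∀ σ₀ σ t T → σ₀ * σ * (t * T) ≡ σ₀ * t * (σ * T)
      shape = solve-∀ ℚ-ring

  harmonic-expansion : ∀ s M →
    ValuationAtLeast p (suc M) (H (p ∸ 1) s - signℚ (sumℕ s) * partialSum p s M)
  harmonic-expansion s M =
    subst (ValuationAtLeast p (suc M)) (sym as-subsetSum)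
      (valuation-subsetSum (p ∸ 1) (length' s) (λ J |J| J<n → product-expansion s J |J| J<n M))
    where
    n = p ∸ 1
    k = length' s
    σ = signℚ (sumℕ s)
    as-subsetSum : H n s - σ * partialSum p s M ≡
                   subsetSum n k (λ J → monomial s J - σ * truncatedExpansion p s J M)
    as-subsetSum = trans (cong₂ (λ h t → h - σ * t) (H≡subsetSum n s) (partialSum≡subsetSum p s M))
                         (sym (subsetSum-sub-* n k σ (monomial s) (λ J → truncatedExpansion p s J M)))

mainTheorem3 : (s : List ℕ) → All (λ x → 1 ≤ x) s → (p : ℕ) → Prime p →
    ∀ (N : ℕ) → ∃[ M ] (∀ (M′ : ℕ) → M ≤ M′ →
      padicClose p N (H (p ∸ 1) s) (signℚ (sumℕ s) * partialSum p s M′))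
-- The positivity hypothesis is unused: the expansion holds for sⱼ = 0 as well.
mainTheorem3 s _ p p-prime N = N , λ M′ N≤M′ →
  valuation⇒padicClose {x = H (p ∸ 1) s} (valuation-weaken (ℕ.m≤n⇒m≤1+n N≤M′) (harmonic-expansion s M′))
  where
  open Valuation p-prime
  open Expansion p-prime
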